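{- Let $D$ be a negative discriminant and let $r>0$ be an integer. Suppose $f_1\in C(Dr^2)$ is derived from $f_2\in C(D)$. Then $\Phi_{Dr^2}(f_1)$ and $\Phi_D(f_2)$ agree on every assigned character that $D$ and $Dr^2$ have in common.
   Context: Binary quadratic forms $(a,b,c)=ax^2+bxy+cy^2$, primitive forms, equivalence under $SL_2(\mathbb{Z})$, and the class group $C(\Delta)$ for $\Delta<0$ are as usual; a form represents $m$ if $f(x,y)=m$ for some integers $x,y$. A primitive form of discriminant $\Delta r^2$ is derived from a form $g$ of discriminant $\Delta$ if it is equivalent to $g(A\cdot(x,y)^T)$ for some integer matrix $A$ with $\det A=r$. Assigned characters: for a negative discriminant $\Delta$ with distinct odd prime divisors $q_1,\dots,q_s$, put $\chi_{q_i}(a)=\left(\frac{a}{q_i}\right)$ (Legendre symbol, $a$ prime to $q_i$), $\delta(a)=\left(\frac{ -1}{a}\right)=(-1)^{(a-1)/2}$ and $\epsilon(a)=\left(\frac{2}{a}\right)=(-1)^{(a^2-1)/8}$ for odd $a$. The assigned characters of $\Delta$ are $\chi_{q_1},\dots,\chi_{q_s}$ together with, if $\Delta=-4m$: none if $m\equiv3\pmod 4$; $\delta$ if $m\equiv1\pmod4$; $\delta\epsilon$ if $m\equiv2\pmod8$; $\epsilon$ if $m\equiv 6\pmod 8$; $\delta$ if $m\equiv4\pmod8$; $\delta$ and $\epsilon$ if $m\equiv0\pmod8$. Writing $\Psi_1,\dots,\Psi_\mu$ for the assigned characters of $\Delta$, the map $\Phi_\Delta:C(\Delta)\to\{\pm1\}^\mu$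 sends the class of $f$ to $(\Psi_1(a),\dots,\Psi_\mu(a))$, where $a$ is any integer represented by $f$ with $\gcd(\Delta,a)=1$; this is a well-defined homomorphism. -}

module Defs where

open import Data.Bool using (Bool; true; false; if_then_else_)
open import Data.Nat as ℕ using (ℕ; suc; _≡ᵇ_)
open import Data.Nat.GCD using (gcd)
open import Data.Nat.Primality using (Prime)
open import Data.Nat.Divisibility using (_∣_)
open import Data.Integer as ℤ using (ℤ; +_; -_; _+_; _*_; _-_; ∣_∣; _%ℕ_; 1ℤ; -1ℤ)
open import Data.List using (upTo)
open import Data.Bool.ListAction using (any)
open import Data.Product using (Σ; ∃; _×_)
open import Data.Sum using (_⊎_)
open import Relation.Binary.PropositionalEquality using (_≡_)

record Form : Set where
  constructor form
  field
    a b c : ℤ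
open Form public

eval : Form → ℤ → ℤ → ℤ
eval (form a b c) x y = a * x * x + b * x * y + c * y * y

disc : Form → ℤ
disc (form a b c) = b * b - (ℤ.+ 4) * a * c

Primitive : Form → Set
Primitive (form a b c) = gcd ∣ a ∣ (gcd ∣ b ∣ ∣ c ∣) ≡ 1

Represents : Form → ℤ → Set
Represents f m = Σ ℤ λ x → Σ ℤ λ y → eval f x y ≡ m

record Mat : Set where
  constructor mat
  field
    p q r s : ℤ

det : Mat → ℤ
det (mat p q r s) = p * s - q * r

-- the form f(A · (x,y)ᵀ) = f(p x + q y , r x + s y), written out coefficientwise
_∘ᶠ_ : Form → Mat → Form
form a b c ∘ᶠ mat p q r s =
  form (a * p * p + b * p * r + c * r * r)
       ((ℤ.+ 2) * a * p * q + b * (p * s + q * r) + (ℤ.+ 2) * c * r * s)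
       (a * q * q + b * q * s + c * s * s)

_≈ᶠ_ : Form → Form → Set
f ≈ᶠ g = Σ Mat λ A → det A ≡ 1ℤ × g ≡ f ∘ᶠ A

InClassGroup : ℤ → Form → Set
InClassGroup Δ f = Primitive f × disc f ≡ Δ × ℤ.+ 0 ℤ.< a f

DerivedFrom : ℕ → Form → Form → Set
DerivedFrom r f₁ g = Σ Mat λ A → det A ≡ ℤ.+ r × (g ∘ᶠ A) ≈ᶠ f₁

NegDisc : ℤ → Set
NegDisc Δ = Δ ℤ.< ℤ.+ 0 × (Δ %ℕ 4 ≡ 0 ⊎ Δ %ℕ 4 ≡ 1)

data Character : Set where
  χ   : ℕ → Character   -- χ_q, q an odd prime
  δ   : Character
  ε   : Character
  δε  : Character

legendre : ℤ → ℕ → ℤ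
legendre a ℕ.zero    = 1ℤ
legendre a (suc k) =
  if any (λ x → ((x ℕ.* x) ℕ.% suc k) ≡ᵇ (a %ℕ suc k)) (upTo (suc k))
  then 1ℤ else -1ℤ

-- δ(a) = (-1)^((a-1)/2) for odd a
δval : ℤ → ℤ
δval a = if (a %ℕ 4) ≡ᵇ 1 then 1ℤ else -1ℤ

-- ε(a) = (-1)^((a²-1)/8) for odd a
εval : ℤ → ℤ
εval a = if ((a %ℕ 8) ≡ᵇ 1) Data.Bool.∨ ((a %ℕ 8) ≡ᵇ 7) then 1ℤ else -1ℤ

charVal : Character → ℤ → ℤ
charVal (χ q) a = legendre a q
charVal δ     a = δval a
charVal ε     a = εval a
charVal δε    a = δval a * εval a

Assigned : ℤ → Character → Set
Assigned Δ (χ q) = Prime q × q ℕ.% 2 ≡ 1 × q ∣ ∣ Δ ∣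
Assigned Δ δ  = Σ ℕ λ m → Δ ≡ - (ℤ.+ (4 ℕ.* m)) ×
                  (m ℕ.% 4 ≡ 1 ⊎ m ℕ.% 8 ≡ 4 ⊎ m ℕ.% 8 ≡ 0)
Assigned Δ ε  = Σ ℕ λ m → Δ ≡ - (ℤ.+ (4 ℕ.* m)) ×
                  (m ℕ.% 8 ≡ 6 ⊎ m ℕ.% 8 ≡ 0)
Assigned Δ δε = Σ ℕ λ m → Δ ≡ - (ℤ.+ (4 ℕ.* m)) × m ℕ.% 8 ≡ 2

-- Each value of f₁ is a value of f₂, because f₁ is f₂ composed with an integer
-- matrix, and a₁, being prime to D r², is prime to D; so only Ψ being assigned to D
-- matters, and it suffices that an assigned character of D agrees on two values
-- a₁ = f(x,y), a₂ = f(z,w) prime to D of one form f of discriminant D.  That comes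
-- from the identity 4 a₁ a₂ = B² − D T² with T = xw − yz.  For an odd prime q ∣ D it
-- makes 4 a₁ a₂ a square mod q, so a₁, a₂ are both squares or both non-squares mod q.
-- For D = −4m the middle coefficient is even and a₁ a₂ = B′² + m T², and the
-- condition on m mod 8 attached to δ, ε or δε forces equal values on odd a₁, a₂:
-- a finite check modulo 8.

module Submission where

open import Defs
open import Data.Bool using (Bool; true; false; T; if_then_else_; not; _∧_; _∨_)
open import Data.Bool.Properties using (T-∧)
open import Data.Bool.ListAction using (any; all)
open import Data.Empty using (⊥-elim)
open import Data.Integer as ℤ using (ℤ; +_; -_; _+_; _*_; _-_; ∣_∣; _%ℕ_; _/ℕ_; 0ℤ; 1ℤ)
open import Data.Integer.DivMod using (a≡a%ℕn+[a/ℕn]*n; n%ℕd<d)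
import Data.Integer.Properties as ℤ
open import Data.Integer.Divisibility.Signed as ℤ using (∣ᵤ⇒∣)
open import Data.Integer.Tactic.RingSolver using (solve-∀)
open import Data.List using (upTo)
open import Data.List.Membership.Propositional.Properties using (∈-upTo⁺)
import Data.List.Relation.Unary.All as All
open import Data.List.Relation.Unary.All.Properties using (all⁺)
import Data.List.Relation.Unary.Any as Any
open import Data.List.Relation.Unary.Any.Properties using (any⁺; any⁻)
open import Data.Nat using (ℕ; zero; suc; NonZero; _≡ᵇ_)
import Data.Nat as ℕ
open import Data.Nat.Coprimality using (Coprime; gcd≡1⇒coprime; prime⇒coprime; coprime-Bézout)
open import Data.Nat.DivMod using (m≡m%n+[m/n]*n; m%n<n)
open import Data.Nat.Divisibility as ℕ using (divides)
open import Data.Nat.GCD using (gcd; module Bézout)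
open import Data.Nat.Primality using (Prime; ¬prime[1]; prime⇒nonZero)
import Data.Nat.Tactic.RingSolver as ℕ-Solver
import Data.Nat.Properties as ℕ
open import Data.Product using (∃-syntax; _,_; proj₁; proj₂)
open import Data.Sum using (_⊎_; inj₁; inj₂)
open import Function.Bundles using (Equivalence)
open import Level using (0ℓ)
open import Relation.Binary.Bundles using (Setoid)
open import Relation.Binary.PropositionalEquality
import Relation.Binary.Reasoning.Setoid
open import Relation.Nullary using (¬_)
open import Relation.Nullary.Decidable using (⌊_⌋; toWitness)

infix 4 _≡_mod_

record _≡_mod_ (u v : ℤ) (q : ℕ) : Set where
  constructor congruent
  field
    quotient : ℤ
    equation : u ≡ v + quotient * + q

module _ {q : ℕ} where

  mod-reflexive : ∀ {u v} → u ≡ v → u ≡ v mod q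
  mod-reflexive {u} refl = congruent 0ℤ (sym (ℤ.+-identityʳ u))

  mod-refl : ∀ {u} → u ≡ u mod q
  mod-refl = mod-reflexive refl

  mod-sym : ∀ {u v} → u ≡ v mod q → v ≡ u mod q
  mod-sym {v = v} (congruent k refl) = congruent (- k) (lemma v k (+ q))
    where lemma : ∀ v k q → v ≡ v + k * q + - k * q
          lemma = solve-∀

  mod-trans : ∀ {u v w} → u ≡ v mod q → v ≡ w mod q → u ≡ w mod q
  mod-trans {w = w} (congruent k refl) (congruent l refl) = congruent (l + k) (lemma w l k (+ q))
    where lemma : ∀ w l k q → w + l * q + k * q ≡ w + (l + k) * q
          lemma = solve-∀

  +-cong-mod : ∀ {u v u′ v′} → u ≡ v mod q → u′ ≡ v′ mod q → u + u′ ≡ v + v′ mod q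
  +-cong-mod {v = v} {v′ = v′} (congruent k refl) (congruent l refl) = congruent (k + l) (lemma v v′ k l (+ q))
    where lemma : ∀ v v′ k l q → v + k * q + (v′ + l * q) ≡ v + v′ + (k + l) * q
          lemma = solve-∀

  *-cong-mod : ∀ {u v u′ v′} → u ≡ v mod q → u′ ≡ v′ mod q → u * u′ ≡ v * v′ mod q
  *-cong-mod {v = v} {v′ = v′} (congruent k refl) (congruent l refl) =
    congruent (k * v′ + v * l + k * l * + q) (lemma v v′ k l (+ q))
    where lemma : ∀ v v′ k l q → (v + k * q) * (v′ + l * q) ≡ v * v′ + (k * v′ + v * l + k * l * q) * q
          lemma = solve-∀

  *-congˡ-mod : ∀ w {u v} → u ≡ v mod q → w * u ≡ w * v mod q
  *-congˡ-mod w = *-cong-mod (mod-refl {w})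

  *-congʳ-mod : ∀ w {u v} → u ≡ v mod q → u * w ≡ v * w mod q
  *-congʳ-mod w u≡v = *-cong-mod u≡v (mod-refl {w})

  ∣⇒≡0-mod : ∀ u → q ℕ.∣ ∣ u ∣ → u ≡ 0ℤ mod q
  ∣⇒≡0-mod u q∣u with ∣ᵤ⇒∣ {+ q} {u} q∣u
  ... | ℤ.divides k u≡kq = congruent k (trans u≡kq (sym (ℤ.+-identityˡ _)))

  ≡0-mod⇒∣ : ∀ {u} → u ≡ 0ℤ mod q → q ℕ.∣ ∣ u ∣
  ≡0-mod⇒∣ (congruent k refl) = divides ∣ k ∣ (trans (cong ∣_∣ (ℤ.+-identityˡ (k * + q))) (ℤ.abs-* k (+ q)))

mod-setoid : ℕ → Setoid 0ℓ 0ℓ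
mod-setoid q = record
  { Carrier       = ℤ
  ; _≈_           = λ u v → u ≡ v mod q
  ; isEquivalence = record { refl = mod-refl ; sym = mod-sym ; trans = mod-trans }
  }

module mod-Reasoning (q : ℕ) = Relation.Binary.Reasoning.Setoid (mod-setoid q)

mod-divisor : ∀ {d q u v} → d ℕ.∣ q → u ≡ v mod q → u ≡ v mod d
mod-divisor {d} {v = v} (divides e refl) (congruent k refl) =
  congruent (k * + e) (cong (_+_ v) (trans (cong (k *_) (ℤ.pos-* e d)) (sym (ℤ.*-assoc k (+ e) (+ d)))))

≡-mod-%ℕ : ∀ q .{{_ : NonZero q}} u → u ≡ + (u %ℕ q) mod q
≡-mod-%ℕ q u = congruent (u /ℕ q) (a≡a%ℕn+[a/ℕn]*n u q)

residue-unique : ∀ {q r s} → r ℕ.< q → s ℕ.< q → + r ≡ + s mod q → r ≡ s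
residue-unique {q} {r} {s} r<q s<q r≡s = ℤ.+-injective (ℤ.i-j≡0⇒i≡j (+ r) (+ s) (ℤ.∣i∣≡0⇒i≡0 distance≡0))
  where
  q∣distance : q ℕ.∣ ∣ + r - + s ∣
  q∣distance = ≡0-mod⇒∣ (mod-trans (+-cong-mod r≡s (mod-refl {u = - + s})) (mod-reflexive (ℤ.+-inverseʳ (+ s))))
  distance<q : ∣ + r - + s ∣ ℕ.< q
  distance<q = ℕ.≤-<-trans (subst (ℕ._≤ r ℕ.⊔ s) (cong ∣_∣ (sym (ℤ.m-n≡m⊖n r s))) (ℤ.∣m⊝n∣≤m⊔n r s))
                           (ℕ.⊔-pres-<m r<q s<q)
  distance≡0 : ∣ + r - + s ∣ ≡ 0
  distance≡0 with ∣ + r - + s ∣ | q∣distance | distance<q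
  ... | zero  | _   | _   = refl
  ... | suc _ | q∣n | n<q = ⊥-elim (ℕ.>⇒∤ n<q q∣n)

mod⇒%ℕ≡ : ∀ q .{{_ : NonZero q}} {u v} → u ≡ v mod q → u %ℕ q ≡ v %ℕ q
mod⇒%ℕ≡ q {u} {v} u≡v = residue-unique (n%ℕd<d u q) (n%ℕd<d v q)
  (mod-trans (mod-sym (≡-mod-%ℕ q u)) (mod-trans u≡v (≡-mod-%ℕ q v)))

%ℕ≡⇒mod : ∀ q .{{_ : NonZero q}} {u v} → u %ℕ q ≡ v %ℕ q → u ≡ v mod q
%ℕ≡⇒mod q {u} {v} eq = mod-trans (≡-mod-%ℕ q u) (subst (λ t → + t ≡ v mod q) (sym eq) (mod-sym (≡-mod-%ℕ q v)))

SquareMod : ℕ → ℤ → Set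
SquareMod q a = ∃[ x ] x * x ≡ a mod q

+-1+m*n≡o*p : ∀ m n o p → 1 ℕ.+ m ℕ.* n ≡ o ℕ.* p → 1ℤ + + m * + n ≡ + o * + p
+-1+m*n≡o*p m n o p eq =
  trans (cong (_+_ 1ℤ) (sym (ℤ.pos-* m n))) (trans (cong +_ eq) (ℤ.pos-* o p))

Bézout⇒inverse-mod : ∀ {q n} → Bézout.Identity 1 q n → ∃[ u ] + n * u ≡ 1ℤ mod q
Bézout⇒inverse-mod {q} {n} (Bézout.+- x y eq) = - + y , congruent (- + x) (begin
  + n * - + y           ≡⟨ lemma (+ n) (+ y) ⟩
  1ℤ - (1ℤ + + y * + n) ≡⟨ cong (λ t → 1ℤ - t) (+-1+m*n≡o*p y n x q eq) ⟩
  1ℤ - + x * + q        ≡⟨ cong (_+_ 1ℤ) (ℤ.neg-distribˡ-* (+ x) (+ q)) ⟩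
  1ℤ + - + x * + q      ∎)
  where
  open ≡-Reasoning
  lemma : ∀ n y → n * - y ≡ 1ℤ - (1ℤ + y * n)
  lemma = solve-∀
Bézout⇒inverse-mod {q} {n} (Bézout.-+ x y eq) = + y , congruent (+ x) (begin
  + n * + y        ≡⟨ ℤ.*-comm (+ n) (+ y) ⟩
  + y * + n        ≡⟨ +-1+m*n≡o*p x q y n eq ⟨
  1ℤ + + x * + q   ∎)
  where open ≡-Reasoning

inverse-mod-prime : ∀ {p} → Prime p → ∀ x → ¬ (x ≡ 0ℤ mod p) → ∃[ u ] x * u ≡ 1ℤ mod p
inverse-mod-prime {p} p-prime x x≢0 =
  u , mod-trans (*-congʳ-mod u (≡-mod-%ℕ p x)) nu≡1
  where
  instance
    p≢0 : NonZero p
    p≢0 = prime⇒nonZero p-prime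
  n = x %ℕ p
  instance
    n≢0 : NonZero n
    n≢0 = ℕ.≢-nonZero (λ n≡0 → x≢0 (mod-trans (≡-mod-%ℕ p x) (mod-reflexive (cong +_ n≡0))))
  inverse = Bézout⇒inverse-mod (coprime-Bézout (prime⇒coprime p-prime (n%ℕd<d x p)))
  u = proj₁ inverse
  nu≡1 = proj₂ inverse

two-inverse-mod-odd : ∀ {q} → q ℕ.% 2 ≡ 1 → + 2 * + suc (q ℕ./ 2) ≡ 1ℤ mod q
two-inverse-mod-odd {q} q-odd = congruent 1ℤ (begin
  + 2 * + suc t                ≡⟨ ℤ.pos-* 2 (suc t) ⟨
  + (2 ℕ.* suc t)              ≡⟨ cong +_ (lemma t) ⟩
  + suc (1 ℕ.+ t ℕ.* 2)        ≡⟨ cong (λ n → + suc n) q≡1+2t ⟨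
  1ℤ + + q                     ≡⟨ cong (_+_ 1ℤ) (ℤ.*-identityˡ (+ q)) ⟨
  1ℤ + 1ℤ * + q                ∎)
  where
  open ≡-Reasoning
  t = q ℕ./ 2
  q≡1+2t : q ≡ 1 ℕ.+ t ℕ.* 2
  q≡1+2t = trans (m≡m%n+[m/n]*n q 2) (cong (ℕ._+ t ℕ.* 2) q-odd)
  lemma : ∀ t → 2 ℕ.* suc t ≡ suc (1 ℕ.+ t ℕ.* 2)
  lemma = ℕ-Solver.solve-∀

-- The witness: a′ ≡ (B / 2x)² where a ≡ x², with 1/2 ≡ (q + 1)/2.
square-transfer : ∀ {q a a′ B} → Prime q → q ℕ.% 2 ≡ 1 → ¬ (a ≡ 0ℤ mod q) →
  + 4 * a * a′ ≡ B * B mod q → SquareMod q a → SquareMod q a′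
square-transfer {q} {a} {a′} {B} q-prime q-odd a≢0 4aa′≡B² (x , x²≡a) = B * u * h , (begin
  B * u * h * (B * u * h)                          ≡⟨ lemma₁ B u h ⟩
  B * B * (u * h * (u * h))                        ≈⟨ *-congʳ-mod (u * h * (u * h)) 4aa′≡B² ⟨
  + 4 * a * a′ * (u * h * (u * h))                 ≈⟨ *-congʳ-mod (u * h * (u * h)) (*-congʳ-mod a′ (*-congˡ-mod (+ 4) x²≡a)) ⟨
  + 4 * (x * x) * a′ * (u * h * (u * h))           ≡⟨ lemma₂ x a′ u h ⟩
  a′ * ((+ 2 * h * (x * u)) * (+ 2 * h * (x * u))) ≈⟨ *-congˡ-mod a′ (*-cong-mod 2hxu≡1 2hxu≡1) ⟩
  a′ * (1ℤ * 1ℤ)                                   ≡⟨ ℤ.*-identityʳ a′ ⟩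
  a′                                               ∎)
  where
  open mod-Reasoning q
  x≢0 : ¬ (x ≡ 0ℤ mod q)
  x≢0 x≡0 = a≢0 (mod-trans (mod-sym x²≡a) (*-cong-mod x≡0 x≡0))
  inverse = inverse-mod-prime q-prime x x≢0
  u = proj₁ inverse
  h = + suc (q ℕ./ 2)
  2hxu≡1 : + 2 * h * (x * u) ≡ 1ℤ mod q
  2hxu≡1 = *-cong-mod (two-inverse-mod-odd q-odd) (proj₂ inverse)
  lemma₁ : ∀ B u h → B * u * h * (B * u * h) ≡ B * B * (u * h * (u * h))
  lemma₁ = solve-∀
  lemma₂ : ∀ x a′ u h → + 4 * (x * x) * a′ * (u * h * (u * h)) ≡ a′ * ((+ 2 * h * (x * u)) * (+ 2 * h * (x * u)))
  lemma₂ = solve-∀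

T-injective : ∀ {x y} → (T x → T y) → (T y → T x) → x ≡ y
T-injective {true}  {true}  _   _   = refl
T-injective {true}  {false} x⇒y _   = ⊥-elim (x⇒y _)
T-injective {false} {true}  _   y⇒x = ⊥-elim (y⇒x _)
T-injective {false} {false} _   _   = refl

isSquareRootᵇ : ∀ q .{{_ : NonZero q}} → ℤ → ℕ → Bool
isSquareRootᵇ q a x = (x ℕ.* x) ℕ.% q ≡ᵇ a %ℕ q

SquareMod⇒any-isSquareRootᵇ : ∀ q .{{_ : NonZero q}} {a} → SquareMod q a → T (any (isSquareRootᵇ q a) (upTo q))
SquareMod⇒any-isSquareRootᵇ q {a} (x , x²≡a) =
  any⁺ (isSquareRootᵇ q a) (Any.map (λ { refl → n-root }) (∈-upTo⁺ (n%ℕd<d x q)))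
  where
  n = x %ℕ q
  n²≡a : + n * + n ≡ a mod q
  n²≡a = mod-trans (mod-sym (*-cong-mod (≡-mod-%ℕ q x) (≡-mod-%ℕ q x))) x²≡a
  n-root : T (isSquareRootᵇ q a n)
  n-root = ℕ.≡⇒≡ᵇ _ _ (trans (cong (_%ℕ q) (ℤ.pos-* n n)) (mod⇒%ℕ≡ q n²≡a))

any-isSquareRootᵇ⇒SquareMod : ∀ q .{{_ : NonZero q}} {a} → T (any (isSquareRootᵇ q a) (upTo q)) → SquareMod q a
any-isSquareRootᵇ⇒SquareMod q {a} root with Any.satisfied (any⁻ (isSquareRootᵇ q a) (upTo q) root)
... | n , n-root = + n , subst (λ t → t ≡ a mod q) (ℤ.pos-* n n) (%ℕ≡⇒mod q (ℕ.≡ᵇ⇒≡ _ _ n-root))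

legendre-resp-SquareMod : ∀ q {a a′} → (SquareMod q a → SquareMod q a′) → (SquareMod q a′ → SquareMod q a) →
  legendre a q ≡ legendre a′ q
legendre-resp-SquareMod zero    _ _ = refl
legendre-resp-SquareMod q@(suc _) a⇒a′ a′⇒a = cong (λ b → if b then 1ℤ else ℤ.-1ℤ)
  (T-injective (λ r → SquareMod⇒any-isSquareRootᵇ q (a⇒a′ (any-isSquareRootᵇ⇒SquareMod q r)))
               (λ r → SquareMod⇒any-isSquareRootᵇ q (a′⇒a (any-isSquareRootᵇ⇒SquareMod q r))))

legendre-≡-of-4aa′≡B² : ∀ {q a a′ B} → Prime q → q ℕ.% 2 ≡ 1 → ¬ (a ≡ 0ℤ mod q) → ¬ (a′ ≡ 0ℤ mod q) →
  + 4 * a * a′ ≡ B * B mod q → legendre a q ≡ legendre a′ q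
legendre-≡-of-4aa′≡B² {q} {a} {a′} {B} q-prime q-odd a≢0 a′≢0 4aa′≡B² = legendre-resp-SquareMod q
  (square-transfer {B = B} q-prime q-odd a≢0 4aa′≡B²)
  (square-transfer {B = B} q-prime q-odd a′≢0 (mod-trans (mod-reflexive (lemma a′ a)) 4aa′≡B²))
  where lemma : ∀ a′ a → + 4 * a′ * a ≡ + 4 * a * a′
        lemma = solve-∀

compositionB : Form → ℤ → ℤ → ℤ → ℤ → ℤ
compositionB (form a b c) x y z w = + 2 * a * x * z + b * (x * w + y * z) + + 2 * c * y * w

4*eval*eval≡B²-disc*T² : ∀ f x y z w →
  + 4 * eval f x y * eval f z w ≡ compositionB f x y z w * compositionB f x y z w - disc f * ((x * w - y * z) * (x * w - y * z))
4*eval*eval≡B²-disc*T² (form a b c) = lemma a b c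
  where lemma : ∀ a b c x y z w →
          + 4 * (a * x * x + b * x * y + c * y * y) * (a * z * z + b * z * w + c * w * w)
            ≡ (+ 2 * a * x * z + b * (x * w + y * z) + + 2 * c * y * w) * (+ 2 * a * x * z + b * (x * w + y * z) + + 2 * c * y * w)
              - (b * b - + 4 * a * c) * ((x * w - y * z) * (x * w - y * z))
        lemma = solve-∀

disc≡-4m⇒b-even : ∀ {a b c m} → disc (form a b c) ≡ - + (4 ℕ.* m) → ∃[ b′ ] b ≡ b′ * + 2
disc≡-4m⇒b-even {a} {b} {c} {m} disc≡-4m with b %ℕ 2 | ≡-mod-%ℕ 2 b | n%ℕd<d b 2
... | 0           | congruent k b≡2k | _ = k , trans b≡2k (ℤ.+-identityˡ _)
... | suc (suc _) | _                | ℕ.s≤s (ℕ.s≤s ())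
... | 1           | congruent k b≡1+2k | _ = ⊥-elim (1≢0 (mod⇒%ℕ≡ 4 (mod-trans (mod-sym b²≡1) b²≡0)))
  where
  1≢0 : ¬ (1 ≡ 0)
  1≢0 ()
  b²≡1 : b * b ≡ 1ℤ mod 4
  b²≡1 = congruent (k + k * k) (trans (cong (λ t → t * t) b≡1+2k) (lemma₁ k))
    where lemma₁ : ∀ k → (1ℤ + k * + 2) * (1ℤ + k * + 2) ≡ 1ℤ + (k + k * k) * + 4
          lemma₁ = solve-∀
  b²≡0 : b * b ≡ 0ℤ mod 4
  b²≡0 = congruent (a * c - + m) (begin
    b * b                             ≡⟨ lemma₂ (b * b) (+ 4 * a * c) ⟩
    b * b - + 4 * a * c + + 4 * a * c ≡⟨ cong (_+ + 4 * a * c) disc≡-4m ⟩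
    - + (4 ℕ.* m) + + 4 * a * c       ≡⟨ cong (λ t → - t + + 4 * a * c) (ℤ.pos-* 4 m) ⟩
    - (+ 4 * + m) + + 4 * a * c       ≡⟨ lemma₃ a c (+ m) ⟩
    0ℤ + (a * c - + m) * + 4          ∎)
    where
    open ≡-Reasoning
    lemma₂ : ∀ u v → u ≡ u - v + v
    lemma₂ = solve-∀
    lemma₃ : ∀ a c m → - (+ 4 * m) + + 4 * a * c ≡ 0ℤ + (a * c - m) * + 4
    lemma₃ = solve-∀

eval*eval≡B²+mT² : ∀ f m → disc f ≡ - + (4 ℕ.* m) → ∀ x y z w →
  ∃[ B ] eval f x y * eval f z w ≡ B * B + + m * ((x * w - y * z) * (x * w - y * z))
eval*eval≡B²+mT² (form a b c) m disc≡-4m x y z w with disc≡-4m⇒b-even {a} {b} {c} {m} disc≡-4m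
... | b′ , refl = B , trans (lemma a b′ c x y z w) (cong (λ t → B * B + t * (t′ * t′)) ac-b′²≡m)
  where
  B = a * x * z + b′ * (x * w + y * z) + c * y * w
  t′ = x * w - y * z
  lemma : ∀ a b′ c x y z w →
    (a * x * x + b′ * + 2 * x * y + c * y * y) * (a * z * z + b′ * + 2 * z * w + c * w * w)
      ≡ (a * x * z + b′ * (x * w + y * z) + c * y * w) * (a * x * z + b′ * (x * w + y * z) + c * y * w)
        + (a * c - b′ * b′) * ((x * w - y * z) * (x * w - y * z))
  lemma = solve-∀
  ac-b′²≡m : a * c - b′ * b′ ≡ + m
  ac-b′²≡m = ℤ.*-cancelˡ-≡ (+ 4) _ _ (begin
    + 4 * (a * c - b′ * b′)                   ≡⟨ lemma′ a b′ c ⟩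
    - disc (form a (b′ * + 2) c)              ≡⟨ cong -_ disc≡-4m ⟩
    - - + (4 ℕ.* m)                           ≡⟨ ℤ.neg-involutive _ ⟩
    + (4 ℕ.* m)                               ≡⟨ ℤ.pos-* 4 m ⟩
    + 4 * + m                                 ∎)
    where
    open ≡-Reasoning
    lemma′ : ∀ a b′ c → + 4 * (a * c - b′ * b′) ≡ - ((b′ * + 2) * (b′ * + 2) - + 4 * a * c)
    lemma′ = solve-∀

twoAdicConditionᵇ : Character → ℕ → Bool
twoAdicConditionᵇ (χ _) _ = false
twoAdicConditionᵇ δ     r = (r ℕ.% 4 ≡ᵇ 1) ∨ (r ≡ᵇ 4) ∨ (r ≡ᵇ 0)
twoAdicConditionᵇ ε     r = (r ≡ᵇ 6) ∨ (r ≡ᵇ 0)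
twoAdicConditionᵇ δε    r = r ≡ᵇ 2

δval-resp-mod4 : ∀ {u v} → u ≡ v mod 4 → δval u ≡ δval v
δval-resp-mod4 u≡v = cong (λ r → if r ≡ᵇ 1 then 1ℤ else ℤ.-1ℤ) (mod⇒%ℕ≡ 4 u≡v)

εval-resp-mod8 : ∀ {u v} → u ≡ v mod 8 → εval u ≡ εval v
εval-resp-mod8 u≡v = cong (λ r → if (r ≡ᵇ 1) ∨ (r ≡ᵇ 7) then 1ℤ else ℤ.-1ℤ) (mod⇒%ℕ≡ 8 u≡v)

charVal-resp-mod8 : ∀ Ψ {r u v} → T (twoAdicConditionᵇ Ψ r) → u ≡ v mod 8 → charVal Ψ u ≡ charVal Ψ v
charVal-resp-mod8 (χ _) ()
charVal-resp-mod8 δ  _ u≡v = δval-resp-mod4 (mod-divisor (divides 2 refl) u≡v)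
charVal-resp-mod8 ε  _ u≡v = εval-resp-mod8 u≡v
charVal-resp-mod8 δε _ u≡v = cong₂ _*_ (δval-resp-mod4 (mod-divisor (divides 2 refl) u≡v)) (εval-resp-mod8 u≡v)

oddᵇ : ℕ → Bool
oddᵇ r = not (r ℕ.% 2 ≡ᵇ 0)

odd-residue-mod8 : ∀ a → ¬ (a ≡ 0ℤ mod 2) → T (oddᵇ (a %ℕ 8))
odd-residue-mod8 a a-odd with (a %ℕ 8) ℕ.% 2 in r≡0
... | suc _ = _
... | zero  = a-odd (mod-trans (mod-divisor (divides 4 refl) (≡-mod-%ℕ 8 a))
                    (mod-trans (≡-mod-%ℕ 2 (+ (a %ℕ 8))) (mod-reflexive (cong +_ r≡0))))

residueCheckᵇ : Character → ℕ → ℕ → ℕ → ℕ → ℕ → Bool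
residueCheckᵇ Ψ m a₁ a₂ B t =
  if twoAdicConditionᵇ Ψ m ∧ oddᵇ a₁ ∧ oddᵇ a₂ ∧ ((+ a₁ * + a₂) %ℕ 8 ≡ᵇ (+ B * + B + + m * (+ t * + t)) %ℕ 8)
  then ⌊ charVal Ψ (+ a₁) ℤ.≟ charVal Ψ (+ a₂) ⌋
  else true

-- Opaque, so that unification can read p off a hypothesis T (allBelow n p).
opaque
  allBelow : ℕ → (ℕ → Bool) → Bool
  allBelow n p = all p (upTo n)

  allBelow-sound : ∀ {n p i} → T (allBelow n p) → i ℕ.< n → T (p i)
  allBelow-sound {n} {p} all-p i<n = All.lookup (all⁺ p (upTo n) all-p) (∈-upTo⁺ i<n)

opaque
  unfolding allBelow

  residueCheck-holds : ∀ Ψ → T (allBelow 8 λ m → allBelow 8 λ a₁ → allBelow 8 λ a₂ → allBelow 8 λ B → allBelow 8 λ t →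
    residueCheckᵇ Ψ m a₁ a₂ B t)
  -- Closed by evaluating the check on all 8⁵ residue tuples.
  residueCheck-holds (χ _) = _
  residueCheck-holds δ     = _
  residueCheck-holds ε     = _
  residueCheck-holds δε    = _

T-if-then-true : ∀ {b c} → T (if b then c else true) → T b → T c
T-if-then-true {true} c _ = c

twoAdic-charVal-≡ : ∀ Ψ m → T (twoAdicConditionᵇ Ψ (m ℕ.% 8)) → ∀ {a₁ a₂} B t →
  a₁ * a₂ ≡ B * B + + m * (t * t) → ¬ (a₁ ≡ 0ℤ mod 2) → ¬ (a₂ ≡ 0ℤ mod 2) → charVal Ψ a₁ ≡ charVal Ψ a₂
twoAdic-charVal-≡ Ψ m cond {a₁} {a₂} B t a₁a₂≡B²+mt² a₁-odd a₂-odd = begin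
  charVal Ψ a₁     ≡⟨ charVal-resp-mod8 Ψ cond (≡-mod-%ℕ 8 a₁) ⟩
  charVal Ψ (+ r₁) ≡⟨ toWitness (T-if-then-true check hypotheses) ⟩
  charVal Ψ (+ r₂) ≡⟨ charVal-resp-mod8 Ψ cond (≡-mod-%ℕ 8 a₂) ⟨
  charVal Ψ a₂     ∎
  where
  open ≡-Reasoning
  rm = m ℕ.% 8
  r₁ = a₁ %ℕ 8
  r₂ = a₂ %ℕ 8
  rB = B %ℕ 8
  rt = t %ℕ 8
  check : T (residueCheckᵇ Ψ rm r₁ r₂ rB rt)
  check = allBelow-sound (allBelow-sound (allBelow-sound (allBelow-sound (allBelow-sound (residueCheck-holds Ψ)
    (m%n<n m 8)) (n%ℕd<d a₁ 8)) (n%ℕd<d a₂ 8)) (n%ℕd<d B 8)) (n%ℕd<d t 8)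
  residues≡ : + r₁ * + r₂ ≡ + rB * + rB + + rm * (+ rt * + rt) mod 8
  residues≡ = mod-trans (*-cong-mod (mod-sym (≡-mod-%ℕ 8 a₁)) (mod-sym (≡-mod-%ℕ 8 a₂)))
    (mod-trans (mod-reflexive a₁a₂≡B²+mt²)
      (+-cong-mod (*-cong-mod (≡-mod-%ℕ 8 B) (≡-mod-%ℕ 8 B))
        (*-cong-mod (≡-mod-%ℕ 8 (+ m)) (*-cong-mod (≡-mod-%ℕ 8 t) (≡-mod-%ℕ 8 t)))))
  hypotheses = Equivalence.from T-∧ (cond , Equivalence.from T-∧ (odd-residue-mod8 a₁ a₁-odd ,
    Equivalence.from T-∧ (odd-residue-mod8 a₂ a₂-odd , ℕ.≡⇒≡ᵇ _ _ (mod⇒%ℕ≡ 8 residues≡))))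

m%8%4≡m%4 : ∀ m → m ℕ.% 8 ℕ.% 4 ≡ m ℕ.% 4
m%8%4≡m%4 m = sym (mod⇒%ℕ≡ 4 (mod-divisor (divides 2 refl) (≡-mod-%ℕ 8 (+ m))))

δ-twoAdicCondition : ∀ m → m ℕ.% 4 ≡ 1 ⊎ m ℕ.% 8 ≡ 4 ⊎ m ℕ.% 8 ≡ 0 → T (twoAdicConditionᵇ δ (m ℕ.% 8))
δ-twoAdicCondition m (inj₁ m≡1) rewrite trans (m%8%4≡m%4 m) m≡1 = _
δ-twoAdicCondition m (inj₂ (inj₁ m≡4)) rewrite m≡4 = _
δ-twoAdicCondition m (inj₂ (inj₂ m≡0)) rewrite m≡0 = _

ε-twoAdicCondition : ∀ m → m ℕ.% 8 ≡ 6 ⊎ m ℕ.% 8 ≡ 0 → T (twoAdicConditionᵇ ε (m ℕ.% 8))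
ε-twoAdicCondition m (inj₁ m≡6) rewrite m≡6 = _
ε-twoAdicCondition m (inj₂ m≡0) rewrite m≡0 = _

δε-twoAdicCondition : ∀ m → m ℕ.% 8 ≡ 2 → T (twoAdicConditionᵇ δε (m ℕ.% 8))
δε-twoAdicCondition m m≡2 rewrite m≡2 = _

coprime-∣ˡ : ∀ {m n k} → m ℕ.∣ n → Coprime n k → Coprime m k
coprime-∣ˡ m∣n coprime (d∣m , d∣k) = coprime (ℕ.∣-trans d∣m m∣n , d∣k)

≢0-mod-of-coprime : ∀ {n q a} → q ℕ.∣ n → Coprime n ∣ a ∣ → q ≢ 1 → ¬ (a ≡ 0ℤ mod q)
≢0-mod-of-coprime q∣n coprime q≢1 a≡0 = q≢1 (coprime (q∣n , ≡0-mod⇒∣ a≡0))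

2∣∣-4m∣ : ∀ m → 2 ℕ.∣ ∣ - + (4 ℕ.* m) ∣
2∣∣-4m∣ m = subst (2 ℕ.∣_) (sym (ℤ.∣-i∣≡∣i∣ (+ (4 ℕ.* m)))) (ℕ.∣-trans (divides 2 refl) (ℕ.m∣m*n m))

odd-of-coprime-to-4m : ∀ {D m a} → D ≡ - + (4 ℕ.* m) → Coprime ∣ D ∣ ∣ a ∣ → ¬ (a ≡ 0ℤ mod 2)
odd-of-coprime-to-4m {m = m} refl coprime = ≢0-mod-of-coprime (2∣∣-4m∣ m) coprime λ ()

twoAdic-charVal-≡-on-values : ∀ Ψ f m {a₁ a₂} → disc f ≡ - + (4 ℕ.* m) → T (twoAdicConditionᵇ Ψ (m ℕ.% 8)) →
  Represents f a₁ → Represents f a₂ → Coprime ∣ disc f ∣ ∣ a₁ ∣ → Coprime ∣ disc f ∣ ∣ a₂ ∣ → charVal Ψ a₁ ≡ charVal Ψ a₂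
twoAdic-charVal-≡-on-values Ψ f m disc≡-4m cond (x , y , refl) (z , w , refl) coprime₁ coprime₂ =
  twoAdic-charVal-≡ Ψ m cond (proj₁ B,eq) (x * w - y * z) (proj₂ B,eq)
    (odd-of-coprime-to-4m {m = m} disc≡-4m coprime₁) (odd-of-coprime-to-4m {m = m} disc≡-4m coprime₂)
  where B,eq = eval*eval≡B²+mT² f m disc≡-4m x y z w

assignedCharacter-constant-on-values : ∀ {D} f → disc f ≡ D → ∀ Ψ → Assigned D Ψ → ∀ {a₁ a₂} →
  Represents f a₁ → Represents f a₂ → Coprime ∣ D ∣ ∣ a₁ ∣ → Coprime ∣ D ∣ ∣ a₂ ∣ → charVal Ψ a₁ ≡ charVal Ψ a₂
assignedCharacter-constant-on-values {D} f refl (χ q) (q-prime , q-odd , q∣D) (x , y , refl) (z , w , refl) coprime₁ coprime₂ =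
  legendre-≡-of-4aa′≡B² {B = B} q-prime q-odd
    (≢0-mod-of-coprime q∣D coprime₁ q≢1) (≢0-mod-of-coprime q∣D coprime₂ q≢1) 4aa′≡B²
  where
  q≢1 : q ≢ 1
  q≢1 refl = ¬prime[1] q-prime
  B = compositionB f x y z w
  t² = (x * w - y * z) * (x * w - y * z)
  4aa′≡B² : + 4 * eval f x y * eval f z w ≡ B * B mod q
  4aa′≡B² with ∣⇒≡0-mod (disc f) q∣D
  ... | congruent k disc≡kq = congruent (- (k * t²)) (begin
    + 4 * eval f x y * eval f z w   ≡⟨ 4*eval*eval≡B²-disc*T² f x y z w ⟩
    B * B - disc f * t²             ≡⟨ cong (λ d → B * B - d * t²) disc≡kq ⟩
    B * B - (0ℤ + k * + q) * t²     ≡⟨ lemma (B * B) t² k (+ q) ⟩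
    B * B + - (k * t²) * + q        ∎)
    where
    open ≡-Reasoning
    lemma : ∀ B² t² k q → B² - (0ℤ + k * q) * t² ≡ B² + - (k * t²) * q
    lemma = solve-∀
assignedCharacter-constant-on-values f refl δ  (m , disc≡-4m , cond) =
  twoAdic-charVal-≡-on-values δ f m disc≡-4m (δ-twoAdicCondition m cond)
assignedCharacter-constant-on-values f refl ε  (m , disc≡-4m , cond) =
  twoAdic-charVal-≡-on-values ε f m disc≡-4m (ε-twoAdicCondition m cond)
assignedCharacter-constant-on-values f refl δε (m , disc≡-4m , cond) =
  twoAdic-charVal-≡-on-values δε f m disc≡-4m (δε-twoAdicCondition m cond)

eval-∘ᶠ : ∀ f A x y → eval (f ∘ᶠ A) x y ≡ eval f (Mat.p A * x + Mat.q A * y) (Mat.r A * x + Mat.s A * y)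
eval-∘ᶠ (form a b c) (mat p q r s) = lemma a b c p q r s
  where
  lemma : ∀ a b c p q r s x y →
    (a * p * p + b * p * r + c * r * r) * x * x
      + (+ 2 * a * p * q + b * (p * s + q * r) + + 2 * c * r * s) * x * y
      + (a * q * q + b * q * s + c * s * s) * y * y
    ≡ a * (p * x + q * y) * (p * x + q * y) + b * (p * x + q * y) * (r * x + s * y) + c * (r * x + s * y) * (r * x + s * y)
  lemma = solve-∀

Represents-∘ᶠ : ∀ f A {m} → Represents (f ∘ᶠ A) m → Represents f m
Represents-∘ᶠ f A (x , y , fA[x,y]≡m) = _ , _ , trans (sym (eval-∘ᶠ f A x y)) fA[x,y]≡m

Represents-derived : ∀ {r f₁ g m} → DerivedFrom r f₁ g → Represents f₁ m → Represents g m
Represents-derived {g = g} (A , _ , M , _ , refl) f₁-rep = Represents-∘ᶠ g A (Represents-∘ᶠ (g ∘ᶠ A) M f₁-rep)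

propositionC4 : (D : ℤ) → NegDisc D → (r : ℕ) → 0 Data.Nat.< r →
    (f₁ f₂ : Form) → InClassGroup (D * + (r Data.Nat.* r)) f₁ → InClassGroup D f₂ →
    DerivedFrom r f₁ f₂ →
    (Ψ : Character) → Assigned D Ψ → Assigned (D * + (r Data.Nat.* r)) Ψ →
    (a₁ a₂ : ℤ) →
    Represents f₁ a₁ → gcd ∣ D * + (r Data.Nat.* r) ∣ ∣ a₁ ∣ ≡ 1 →
    Represents f₂ a₂ → gcd ∣ D ∣ ∣ a₂ ∣ ≡ 1 →
    charVal Ψ a₁ ≡ charVal Ψ a₂
propositionC4 D _ r _ f₁ f₂ _ (_ , disc-f₂≡D , _) f₁-derived Ψ Ψ-assigned _ a₁ a₂ f₁-rep gcd₁≡1 f₂-rep gcd₂≡1 =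
  assignedCharacter-constant-on-values f₂ disc-f₂≡D Ψ Ψ-assigned (Represents-derived {g = f₂} f₁-derived f₁-rep) f₂-rep
    (coprime-∣ˡ ∣D∣∣∣Dr²∣ (gcd≡1⇒coprime gcd₁≡1)) (gcd≡1⇒coprime gcd₂≡1)
  where
  ∣D∣∣∣Dr²∣ : ∣ D ∣ ℕ.∣ ∣ D * + (r ℕ.* r) ∣
  ∣D∣∣∣Dr²∣ = subst (∣ D ∣ ℕ.∣_) (sym (ℤ.abs-* D (+ (r ℕ.* r)))) (ℕ.m∣m*n (r ℕ.* r))
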